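{- Let $\mathcal{T}_0=\{T^\flat,T^\dagger,T^\ddagger,T^\sharp\}$ and $\mathcal{T}_{k+1}=\{S\otimes T: S,T\in\mathcal{T}_k\}$ for $k\geqslant0$. Let $d\geqslant 4$ be an integer. For an integer $k\geqslant0$ put $\rho=3\cdot 2^k+k+1$, $\rho'=\rho+2^k$, $\rho''=\rho'+2^k$, $\rho'''=\rho''+2^k$. Then there is a unique integer $k\geqslant 0$ such that $d$ satisfies one of (a) $\rho\leqslant d<\rho'$; (a') $\rho'\leqslant d<\rho''$; (a'') $\rho''\leqslant d\leqslant\rho'''$. Moreover, for this $k$: if (a) holds then $(\rho'-d)\cdot[T^\flat]+(d-\rho)\cdot[T^\dagger]$ is an elementary decomposition of some $T\in\mathcal{T}_k$ with $\delta(T)=d$; if (a') holds then $(\rho''-d)\cdot[T^\dagger]+(d-\rho')\cdot[T^\ddagger]$ is an elementary decomposition of some $T\in\mathcal{T}_k$ with $\delta(T)=d$; if (a'') holds then $(\rho'''-d)\cdot[T^\ddagger]+(d-\rho'')\cdot[T^\sharp]$ is an elementary decomposition of some $T\in\mathcal{T}_k$ with $\delta(T)=d$.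
   Context: Let $S=\{0,1,*\}$; elements of $S^d$ are strings of length $d$. A list is a finite sequence of elements (strings of a common length, or, below, triples), repetitions allowed; $|L|$ is its number of entries; $[x]$ is the one-entry list of $x$; $*^m$ is the string of $m$ jokers $*$. Operations on lists of strings: pairing $[v_1,\dots,v_n]\ominus[w_1,\dots,w_n]=[v_1w_1,\dots,v_nw_n]$; concatenation $AB=[v_iw_j]$ (all pairs, ordered lexicographically in $(i,j)$). For any lists, $A+B$ = entries of $A$ followed by entries of $B$; $1\cdot A=A$, $(k+1)\cdot A=k\cdot A+A$, and $0\cdot A$ is the empty list; concatenation before sum. For a triple of lists $T=(A,B,C)$: $\alpha(T)$, $\beta(T)$ are the lengths of the strings in $A$, $B$; $\delta(T)=\alpha(T)+\beta(T)$; $g(T)=|C|$. The compound of triples $T=(A,B,C)$, $T'=(A',B',C')$ with $\alpha(T)=\alpha(T')$ is $T\otimes T'=(A'',B'',C'')$ with $A''=[0]A+[0]A'+[1]\big((g(T)g(T'))\cdot[*^{\alpha(T)}]\big)$, $B''=[0]B[*^{\beta(T')}]+[1][*^{\beta(T)}]B'+[*]CC'$, $C''=[0]C[*^{\beta(T')}]+[1][*^{\beta(T)}]C'$. Let $G=[0,1]$, $H=[00,01,1*]$, $L_0=[000,001,01*,1**]$. Define $T^\flat=(3\cdot[00]+3\cdot[01]+3\cdot[1*],\ 3\cdot H,\ H)$; $T^\dagger=(4\cdot[00]+4\cdot[01]+4\cdot[1*],\ 3\cdot L_0,\ L_0)$; $T^\ddagger=(2\cdot[00]+2\cdot[01]+3\cdot[00]+3\cdot[01]+6\cdot[1*],\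 2\cdot([0]G[**])+2\cdot([1][*]H)+[*]GH,\ [0]G[**]+[1][*]H)$; $T^\sharp=(2\cdot(3\cdot[00]+3\cdot[01])+9\cdot[1*],\ 2\cdot([0]H[**])+2\cdot([1][**]H)+[*]HH,\ [0]H[**]+[1][**]H)$. Elementary decomposition: for a list $[S_1,\dots,S_{2^k}]$ of triples from $\{T^\flat,T^\dagger,T^\ddagger,T^\sharp\}$ define $\bigotimes[S_1]=S_1$ and, for $k\geqslant1$, $\bigotimes[S_1,\dots,S_{2^k}]=\bigotimes[S_1\otimes S_2,\,S_3\otimes S_4,\,\dots,\,S_{2^k-1}\otimes S_{2^k}]$. A list $L$ of length $2^k$ with entries in $\{T^\flat,T^\dagger,T^\ddagger,T^\sharp\}$ is an elementary decomposition of $T$ if $T=\bigotimes L$. -}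

module Defs where

open import Data.Nat using (ℕ; zero; suc; _+_; _*_; _∸_; _^_; _≤_; _<_)
open import Data.Nat.Properties using (_≟_)
open import Data.List using (List; []; _∷_; _++_; map; concatMap; length; [_])
open import Data.List.Membership.Propositional using (_∈_)
open import Data.List.Relation.Unary.All using (All)
open import Data.Vec using (Vec) renaming ([] to ⟨⟩; _∷_ to _∷ᵛ_; _++_ to _++ᵛ_; replicate to replicateᵛ)
open import Data.Maybe using (Maybe; just; nothing; _>>=_)
open import Data.Product using (Σ; _×_; _,_)
open import Data.Sum using (_⊎_)
open import Relation.Binary.PropositionalEquality using (_≡_; subst; sym)
open import Relation.Nullary using (yes; no)

data Sym : Set where
  s0 s1 s* : Sym

Str : ℕ → Set
Str = Vec Sym

_·_ : ∀ {a} {X : Set a} → ℕ → List X → List X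
zero · A = []
suc k · A = (k · A) ++ A
infixr 7 _·_

_⊙_ : ∀ {m n} → List (Str m) → List (Str n) → List (Str (m + n))
A ⊙ B = concatMap (λ v → map (λ w → v ++ᵛ w) B) A
infixl 8 _⊙_

jokers : (m : ℕ) → List (Str m)
jokers m = [ replicateᵛ m s* ]

[0] [1] [*] : List (Str 1)
[0] = [ s0 ∷ᵛ ⟨⟩ ]
[1] = [ s1 ∷ᵛ ⟨⟩ ]
[*] = [ s* ∷ᵛ ⟨⟩ ]

record Triple : Set where
  constructor triple
  field
    α β : ℕ
    A : List (Str α)
    B : List (Str β)
    C : List (Str β)
open Triple public

δ : Triple → ℕ
δ T = α T + β T

g : Triple → ℕ
g T = length (C T)

compound : (T T' : Triple) → α T ≡ α T' → Triple
compound T T' p = triple (suc (α T)) (suc (β T + β T'))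
  ([0] ⊙ A T ++ [0] ⊙ A' ++ [1] ⊙ ((g T * g T') · jokers (α T)))
  ([0] ⊙ B T ⊙ jokers (β T') ++ [1] ⊙ jokers (β T) ⊙ B T' ++ [*] ⊙ C T ⊙ C T')
  ([0] ⊙ C T ⊙ jokers (β T') ++ [1] ⊙ jokers (β T) ⊙ C T')
  where
  A' : List (Str (α T))
  A' = subst (λ n → List (Str n)) (sym p) (A T')

compoundM : Triple → Triple → Maybe Triple
compoundM T T' with α T ≟ α T'
... | yes p = just (compound T T' p)
... | no _ = nothing

s00 s01 s1* : Str 2
s00 = s0 ∷ᵛ s0 ∷ᵛ ⟨⟩
s01 = s0 ∷ᵛ s1 ∷ᵛ ⟨⟩
s1* = s1 ∷ᵛ s* ∷ᵛ ⟨⟩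

G : List (Str 1)
G = [0] ++ [1]

H : List (Str 2)
H = s00 ∷ s01 ∷ s1* ∷ []

L₀ : List (Str 3)
L₀ = (s0 ∷ᵛ s0 ∷ᵛ s0 ∷ᵛ ⟨⟩) ∷ (s0 ∷ᵛ s0 ∷ᵛ s1 ∷ᵛ ⟨⟩) ∷ (s0 ∷ᵛ s1 ∷ᵛ s* ∷ᵛ ⟨⟩) ∷ (s1 ∷ᵛ s* ∷ᵛ s* ∷ᵛ ⟨⟩) ∷ []

T♭ : Triple
T♭ = triple 2 2 (3 · [ s00 ] ++ 3 · [ s01 ] ++ 3 · [ s1* ]) (3 · H) H

T† : Triple
T† = triple 2 3 (4 · [ s00 ] ++ 4 · [ s01 ] ++ 4 · [ s1* ]) (3 · L₀) L₀

T‡ : Triple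
T‡ = triple 2 4
  (2 · [ s00 ] ++ 2 · [ s01 ] ++ 3 · [ s00 ] ++ 3 · [ s01 ] ++ 6 · [ s1* ])
  (2 · ([0] ⊙ G ⊙ jokers 2) ++ 2 · ([1] ⊙ jokers 1 ⊙ H) ++ [*] ⊙ G ⊙ H)
  ([0] ⊙ G ⊙ jokers 2 ++ [1] ⊙ jokers 1 ⊙ H)

T♯ : Triple
T♯ = triple 2 5
  (2 · (3 · [ s00 ] ++ 3 · [ s01 ]) ++ 9 · [ s1* ])
  (2 · ([0] ⊙ H ⊙ jokers 2) ++ 2 · ([1] ⊙ jokers 2 ⊙ H) ++ [*] ⊙ H ⊙ H)
  ([0] ⊙ H ⊙ jokers 2 ++ [1] ⊙ jokers 2 ⊙ H)

𝒯₀ : List Triple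
𝒯₀ = T♭ ∷ T† ∷ T‡ ∷ T♯ ∷ []

data 𝒯 : ℕ → Triple → Set where
  base : ∀ {T} → T ∈ 𝒯₀ → 𝒯 zero T
  step : ∀ {k S T} → 𝒯 k S → 𝒯 k T → (p : α S ≡ α T) → 𝒯 (suc k) (compound S T p)

pairUp : List Triple → Maybe (List Triple)
pairUp [] = just []
pairUp (_ ∷ []) = nothing
pairUp (S ∷ S' ∷ rest) = compoundM S S' >>= λ U → pairUp rest >>= λ R → just (U ∷ R)

⨂ : ℕ → List Triple → Maybe Triple
⨂ zero (S ∷ []) = just S
⨂ zero _ = nothing
⨂ (suc k) L = pairUp L >>= ⨂ k

ElemDecomp : List Triple → Triple → Set
ElemDecomp L T = All (_∈ 𝒯₀) L × Σ ℕ (λ k → (length L ≡ 2 ^ k) × (⨂ k L ≡ just T))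

ρ ρ′ ρ″ ρ‴ : ℕ → ℕ
ρ k = 3 * 2 ^ k + k + 1
ρ′ k = ρ k + 2 ^ k
ρ″ k = ρ′ k + 2 ^ k
ρ‴ k = ρ″ k + 2 ^ k

CaseA CaseA′ CaseA″ : ℕ → ℕ → Set
CaseA k d = ρ k ≤ d × d < ρ′ k
CaseA′ k d = ρ′ k ≤ d × d < ρ″ k
CaseA″ k d = ρ″ k ≤ d × d ≤ ρ‴ k

OneOf : ℕ → ℕ → Set
OneOf k d = CaseA k d ⊎ CaseA′ k d ⊎ CaseA″ k d

DecompIn : ℕ → ℕ → List Triple → Set
DecompIn k d L = Σ Triple (λ T → 𝒯 k T × δ T ≡ d × ElemDecomp L T)

{-# OPTIONS --safe #-}
module Submission where

-- Write weight T = β T + 1. Compounding adds weights and raises α by one, so the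
-- compound of 2^k base triples (all with α = 2) has δ = k + 1 + (sum of the weights).
-- T♭, T†, T‡, T♯ have weights 3, 4, 5, 6; mixing f copies of weight c with e copies of
-- weight c + 1, f + e = 2^k, gives δ = k + 1 + c·2^k + e, and ρ, ρ′, ρ″ are k + 1 + c·2^k
-- for c = 3, 4, 5. Finally ρ 0 = 4 and ρ (k + 1) = ρ‴ k + 1, so the segments
-- [ρ k, ρ‴ k] partition the integers d ≥ 4.

open import Defs
open import Data.Nat using (ℕ; zero; suc; _+_; _*_; _^_; _∸_; _≤_; _<_; _≮_; z≤n; s≤s; s≤s⁻¹; _≤?_; _<?_)
open import Data.Nat.Properties
open import Data.Nat.ListAction using (sum)
open import Data.Nat.ListAction.Properties using (sum-++)
open import Data.Nat.Tactic.RingSolver using (solve-∀)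
open import Data.List using (List; []; _∷_; [_]; _++_; _∷ʳ_; length; map; replicate)
open import Data.List.Properties using (length-++; length-replicate; map-++; map-replicate)
open import Data.List.Membership.Propositional using (_∈_)
open import Data.List.Relation.Unary.All as All using (All; []; _∷_)
open import Data.List.Relation.Unary.All.Properties using (++⁺; replicate⁺)
open import Data.List.Relation.Unary.Any using (here; there)
open import Data.Maybe using (just; _>>=_)
open import Data.Product using (Σ; _×_; _,_; ∃-syntax)
open import Data.Sum using (inj₁; inj₂)
open import Data.Empty using (⊥-elim)
open import Relation.Nullary using (yes; no)
open import Relation.Binary.PropositionalEquality
  using (_≡_; refl; sym; trans; cong; cong₂; subst; module ≡-Reasoning)

open ≡-Reasoning

Segment : (ℕ → ℕ) → ℕ → ℕ → Set
Segment f k d = f k ≤ d × d < f (suc k)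

module _ {f : ℕ → ℕ} (f-increasing : ∀ n → f n < f (suc n)) where

  increasing⇒monotone : ∀ {m n} → m ≤ n → f m ≤ f n
  increasing⇒monotone {n = zero} z≤n = ≤-refl
  increasing⇒monotone {n = suc n} m≤1+n with m≤n⇒m<n∨m≡n m≤1+n
  ... | inj₁ m<1+n = ≤-trans (increasing⇒monotone (s≤s⁻¹ m<1+n)) (<⇒≤ (f-increasing n))
  ... | inj₂ refl = ≤-refl

  n<f[1+n] : ∀ n → n < f (suc n)
  n<f[1+n] zero = ≤-<-trans z≤n (f-increasing 0)
  n<f[1+n] (suc n) = ≤-<-trans (n<f[1+n] n) (f-increasing (suc n))

  segment-exists : ∀ {d} → f 0 ≤ d → ∃[ k ] Segment f k d
  segment-exists {d} f0≤d = search (suc d) (n<f[1+n] d)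
    where
    search : ∀ n → d < f n → ∃[ k ] Segment f k d
    search zero d<f0 = ⊥-elim (<⇒≱ d<f0 f0≤d)
    search (suc n) d<f[1+n] with f n ≤? d
    ... | yes fn≤d = n , fn≤d , d<f[1+n]
    ... | no fn≰d = search n (≰⇒> fn≰d)

  segment-unique : ∀ {k k′ d} → Segment f k d → Segment f k′ d → k ≡ k′
  segment-unique s s′ = ≤-antisym (≮⇒≥ (no-later-segment s′ s)) (≮⇒≥ (no-later-segment s s′))
    where
    no-later-segment : ∀ {k k′ d} → Segment f k d → Segment f k′ d → k ≮ k′
    no-later-segment (_ , d<f[1+k]) (fk′≤d , _) k<k′ =
      <⇒≱ d<f[1+k] (≤-trans (increasing⇒monotone k<k′) fk′≤d)

[m+n∸o]+[o∸m]≡n : ∀ {m n o} → m ≤ o → o ≤ m + n → (m + n ∸ o) + (o ∸ m) ≡ n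
[m+n∸o]+[o∸m]≡n {m} {n} {o} m≤o o≤m+n = begin
  (m + n ∸ o) + (o ∸ m)  ≡⟨ +-∸-assoc (m + n ∸ o) m≤o ⟨
  (m + n ∸ o) + o ∸ m    ≡⟨ cong (_∸ m) (m∸n+n≡m o≤m+n) ⟩
  m + n ∸ m              ≡⟨ m+n∸m≡n m n ⟩
  n                      ∎

f*c+e*[1+c]≡c*[f+e]+e : ∀ f e c → f * c + e * suc c ≡ c * (f + e) + e
f*c+e*[1+c]≡c*[f+e]+e = solve-∀

sum-replicate : ∀ n m → sum (replicate n m) ≡ n * m
sum-replicate zero m = refl
sum-replicate (suc n) m = cong (m +_) (sum-replicate n m)

replicate-∷ʳ : ∀ {A : Set} n (x : A) → replicate n x ∷ʳ x ≡ replicate (suc n) x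
replicate-∷ʳ zero x = refl
replicate-∷ʳ (suc n) x = cong (x ∷_) (replicate-∷ʳ n x)

·[x]≡replicate : ∀ {A : Set} n (x : A) → n · [ x ] ≡ replicate n x
·[x]≡replicate zero x = refl
·[x]≡replicate (suc n) x = trans (cong (_∷ʳ x) (·[x]≡replicate n x)) (replicate-∷ʳ n x)

length-·[x] : ∀ {A : Set} n (x : A) → length (n · [ x ]) ≡ n
length-·[x] n x = trans (cong length (·[x]≡replicate n x)) (length-replicate n)

All-·[x] : ∀ {A : Set} {P : A → Set} n {x} → P x → All P (n · [ x ])
All-·[x] {P = P} n {x} px = subst (All P) (sym (·[x]≡replicate n x)) (replicate⁺ n px)

weight : Triple → ℕ
weight T = suc (β T)

totalWeight : List Triple → ℕ
totalWeight L = sum (map weight L)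

totalWeight-++ : ∀ L L′ → totalWeight (L ++ L′) ≡ totalWeight L + totalWeight L′
totalWeight-++ L L′ = trans (cong sum (map-++ weight L L′)) (sum-++ (map weight L) (map weight L′))

totalWeight-·[x] : ∀ n T → totalWeight (n · [ T ]) ≡ n * weight T
totalWeight-·[x] n T = begin
  totalWeight (n · [ T ])            ≡⟨ cong totalWeight (·[x]≡replicate n T) ⟩
  sum (map weight (replicate n T))   ≡⟨ cong sum (map-replicate weight n T) ⟩
  sum (replicate n (weight T))       ≡⟨ sum-replicate n (weight T) ⟩
  n * weight T                       ∎

weight-compound : ∀ S T p → weight (compound S T p) ≡ weight S + weight T
weight-compound S T p = cong suc (sym (+-suc (β S) (β T)))

compoundM-just : ∀ {S T} (p : α S ≡ α T) → compoundM S T ≡ just (compound S T p)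
compoundM-just p rewrite ≟-diag p = refl

α-𝒯₀ : ∀ {T} → T ∈ 𝒯₀ → α T ≡ 2
α-𝒯₀ = All.lookup {P = λ T → α T ≡ 2} (refl ∷ refl ∷ refl ∷ refl ∷ [])

α-𝒯 : ∀ {j T} → 𝒯 j T → α T ≡ 2 + j
α-𝒯 (base T∈𝒯₀) = α-𝒯₀ T∈𝒯₀
α-𝒯 (step S∈𝒯 _ _) = cong suc (α-𝒯 S∈𝒯)

δ-𝒯 : ∀ {k T} → 𝒯 k T → δ T ≡ suc k + weight T
δ-𝒯 {k} {T} T∈𝒯 = begin
  α T + β T          ≡⟨ cong (_+ β T) (α-𝒯 T∈𝒯) ⟩
  2 + k + β T        ≡⟨ cong suc (+-suc k (β T)) ⟨
  suc k + weight T   ∎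

-- m * 2 rather than 2 * m: at m = suc m′ it unfolds to 2 + m′ * 2, matching a two-element head.
pairUp-𝒯 : ∀ m {j L} → All (𝒯 j) L → length L ≡ m * 2 →
  Σ (List Triple) λ L′ → pairUp L ≡ just L′ × All (𝒯 (suc j)) L′
    × length L′ ≡ m × totalWeight L′ ≡ totalWeight L
pairUp-𝒯 zero [] refl = [] , refl , [] , refl , refl
pairUp-𝒯 (suc m) {L = S ∷ T ∷ L} (S∈𝒯 ∷ T∈𝒯 ∷ L∈𝒯) length≡
  with pairUp-𝒯 m L∈𝒯 (suc-injective (suc-injective length≡))
... | L′ , pairUp≡ , L′∈𝒯 , length′≡ , weight′≡ =
  compound S T p ∷ L′ , pairUp-cons , step S∈𝒯 T∈𝒯 p ∷ L′∈𝒯 , cong suc length′≡ , weight≡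
  where
  p : α S ≡ α T
  p = trans (α-𝒯 S∈𝒯) (sym (α-𝒯 T∈𝒯))
  pairUp-cons : pairUp (S ∷ T ∷ L) ≡ just (compound S T p ∷ L′)
  pairUp-cons = begin
    (compoundM S T >>= λ U → pairUp L >>= λ R → just (U ∷ R))
      ≡⟨ cong (_>>= λ U → pairUp L >>= λ R → just (U ∷ R)) (compoundM-just p) ⟩
    (pairUp L >>= λ R → just (compound S T p ∷ R))
      ≡⟨ cong (_>>= λ R → just (compound S T p ∷ R)) pairUp≡ ⟩
    just (compound S T p ∷ L′)
      ∎
  weight≡ : weight (compound S T p) + totalWeight L′ ≡ weight S + (weight T + totalWeight L)
  weight≡ = begin
    weight (compound S T p) + totalWeight L′  ≡⟨ cong₂ _+_ (weight-compound S T p) weight′≡ ⟩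
    weight S + weight T + totalWeight L       ≡⟨ +-assoc (weight S) (weight T) (totalWeight L) ⟩
    weight S + (weight T + totalWeight L)     ∎

⨂-𝒯 : ∀ k {j L} → All (𝒯 j) L → length L ≡ 2 ^ k →
  Σ Triple λ T → ⨂ k L ≡ just T × 𝒯 (j + k) T × weight T ≡ totalWeight L
⨂-𝒯 zero {j} {T ∷ []} (T∈𝒯 ∷ []) refl =
  T , refl , subst (λ i → 𝒯 i T) (sym (+-identityʳ j)) T∈𝒯 , sym (+-identityʳ (weight T))
⨂-𝒯 (suc k) {j} {L} L∈𝒯 length≡
  with pairUp-𝒯 (2 ^ k) L∈𝒯 (trans length≡ (*-comm 2 (2 ^ k)))
... | L′ , pairUp≡ , L′∈𝒯 , length′≡ , weight′≡ with ⨂-𝒯 k L′∈𝒯 length′≡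
... | T , ⨂≡ , T∈𝒯 , weight≡ =
  T , trans (cong (_>>= ⨂ k) pairUp≡) ⨂≡ , subst (λ i → 𝒯 i T) (sym (+-suc j k)) T∈𝒯 ,
  trans weight≡ weight′≡

elemDecomp : ∀ k {L} → All (_∈ 𝒯₀) L → length L ≡ 2 ^ k → DecompIn k (suc k + totalWeight L) L
elemDecomp k L∈𝒯₀ length≡ with ⨂-𝒯 k (All.map base L∈𝒯₀) length≡
... | T , ⨂≡ , T∈𝒯 , weight≡ =
  T , T∈𝒯 , trans (δ-𝒯 T∈𝒯) (cong (suc k +_) weight≡) , L∈𝒯₀ , k , length≡ , ⨂≡

decompIn-mix : ∀ {X Y c} → X ∈ 𝒯₀ → Y ∈ 𝒯₀ → weight X ≡ c → weight Y ≡ suc c →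
  ∀ {k r d} → r ≡ suc k + c * 2 ^ k → r ≤ d → d ≤ r + 2 ^ k →
  DecompIn k d ((r + 2 ^ k ∸ d) · [ X ] ++ (d ∸ r) · [ Y ])
decompIn-mix {X} {Y} {c} X∈𝒯₀ Y∈𝒯₀ weightX weightY {k} {r} {d} r≡ r≤d d≤r+2^k =
  subst (λ i → DecompIn k i L) δ≡d (elemDecomp k L∈𝒯₀ length≡)
  where
  f e : ℕ
  f = r + 2 ^ k ∸ d
  e = d ∸ r
  L : List Triple
  L = f · [ X ] ++ e · [ Y ]
  f+e≡2^k : f + e ≡ 2 ^ k
  f+e≡2^k = [m+n∸o]+[o∸m]≡n r≤d d≤r+2^k
  L∈𝒯₀ : All (_∈ 𝒯₀) L
  L∈𝒯₀ = ++⁺ (All-·[x] f X∈𝒯₀) (All-·[x] e Y∈𝒯₀)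
  length≡ : length L ≡ 2 ^ k
  length≡ = trans (length-++ (f · [ X ])) (trans (cong₂ _+_ (length-·[x] f X) (length-·[x] e Y)) f+e≡2^k)
  totalWeight≡ : totalWeight L ≡ c * 2 ^ k + e
  totalWeight≡ = begin
    totalWeight L                                      ≡⟨ totalWeight-++ (f · [ X ]) (e · [ Y ]) ⟩
    totalWeight (f · [ X ]) + totalWeight (e · [ Y ])  ≡⟨ cong₂ _+_ (totalWeight-·[x] f X) (totalWeight-·[x] e Y) ⟩
    f * weight X + e * weight Y                        ≡⟨ cong₂ (λ a b → f * a + e * b) weightX weightY ⟩
    f * c + e * suc c                                  ≡⟨ f*c+e*[1+c]≡c*[f+e]+e f e c ⟩
    c * (f + e) + e                                    ≡⟨ cong (λ n → c * n + e) f+e≡2^k ⟩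
    c * 2 ^ k + e                                      ∎
  δ≡d : suc k + totalWeight L ≡ d
  δ≡d = begin
    suc k + totalWeight L    ≡⟨ cong (suc k +_) totalWeight≡ ⟩
    suc k + (c * 2 ^ k + e)  ≡⟨ +-assoc (suc k) (c * 2 ^ k) e ⟨
    suc k + c * 2 ^ k + e    ≡⟨ cong (_+ e) r≡ ⟨
    r + e                    ≡⟨ m+[n∸m]≡n r≤d ⟩
    d                        ∎

ρ[1+k]≡1+ρ‴ : ∀ k → ρ (suc k) ≡ suc (ρ‴ k)
ρ[1+k]≡1+ρ‴ k = arith k (2 ^ k)
  where
  arith : ∀ k x → 3 * (2 * x) + suc k + 1 ≡ suc (3 * x + k + 1 + x + x + x)
  arith = solve-∀

ρ≡1+k+3*2^k : ∀ k → ρ k ≡ suc k + 3 * 2 ^ k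
ρ≡1+k+3*2^k k = arith k (2 ^ k)
  where
  arith : ∀ k x → 3 * x + k + 1 ≡ suc k + 3 * x
  arith = solve-∀

ρ′≡1+k+4*2^k : ∀ k → ρ′ k ≡ suc k + 4 * 2 ^ k
ρ′≡1+k+4*2^k k = arith k (2 ^ k)
  where
  arith : ∀ k x → 3 * x + k + 1 + x ≡ suc k + 4 * x
  arith = solve-∀

ρ″≡1+k+5*2^k : ∀ k → ρ″ k ≡ suc k + 5 * 2 ^ k
ρ″≡1+k+5*2^k k = arith k (2 ^ k)
  where
  arith : ∀ k x → 3 * x + k + 1 + x + x ≡ suc k + 5 * x
  arith = solve-∀

ρ≤ρ′ : ∀ k → ρ k ≤ ρ′ k
ρ≤ρ′ k = m≤m+n (ρ k) (2 ^ k)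

ρ′≤ρ″ : ∀ k → ρ′ k ≤ ρ″ k
ρ′≤ρ″ k = m≤m+n (ρ′ k) (2 ^ k)

ρ″≤ρ‴ : ∀ k → ρ″ k ≤ ρ‴ k
ρ″≤ρ‴ k = m≤m+n (ρ″ k) (2 ^ k)

≤ρ‴⇒<ρ[1+k] : ∀ {k d} → d ≤ ρ‴ k → d < ρ (suc k)
≤ρ‴⇒<ρ[1+k] {k} {d} d≤ρ‴ = subst (d <_) (sym (ρ[1+k]≡1+ρ‴ k)) (s≤s d≤ρ‴)

ρ-increasing : ∀ k → ρ k < ρ (suc k)
ρ-increasing k = ≤ρ‴⇒<ρ[1+k] (≤-trans (ρ≤ρ′ k) (≤-trans (ρ′≤ρ″ k) (ρ″≤ρ‴ k)))

oneOf⇒segment : ∀ {k d} → OneOf k d → Segment ρ k d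
oneOf⇒segment {k} (inj₁ (ρ≤d , d<ρ′)) =
  ρ≤d , ≤ρ‴⇒<ρ[1+k] (≤-trans (<⇒≤ d<ρ′) (≤-trans (ρ′≤ρ″ k) (ρ″≤ρ‴ k)))
oneOf⇒segment {k} (inj₂ (inj₁ (ρ′≤d , d<ρ″))) =
  ≤-trans (ρ≤ρ′ k) ρ′≤d , ≤ρ‴⇒<ρ[1+k] (≤-trans (<⇒≤ d<ρ″) (ρ″≤ρ‴ k))
oneOf⇒segment {k} (inj₂ (inj₂ (ρ″≤d , d≤ρ‴))) =
  ≤-trans (≤-trans (ρ≤ρ′ k) (ρ′≤ρ″ k)) ρ″≤d , ≤ρ‴⇒<ρ[1+k] d≤ρ‴

segment⇒oneOf : ∀ {k d} → Segment ρ k d → OneOf k d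
segment⇒oneOf {k} {d} (ρ≤d , d<ρ[1+k]) with d <? ρ′ k | d <? ρ″ k
... | yes d<ρ′ | _ = inj₁ (ρ≤d , d<ρ′)
... | no d≮ρ′ | yes d<ρ″ = inj₂ (inj₁ (≮⇒≥ d≮ρ′ , d<ρ″))
... | no _ | no d≮ρ″ = inj₂ (inj₂ (≮⇒≥ d≮ρ″ , s≤s⁻¹ (subst (d <_) (ρ[1+k]≡1+ρ‴ k) d<ρ[1+k])))

T♭∈𝒯₀ : T♭ ∈ 𝒯₀
T♭∈𝒯₀ = here refl

T†∈𝒯₀ : T† ∈ 𝒯₀
T†∈𝒯₀ = there (here refl)

T‡∈𝒯₀ : T‡ ∈ 𝒯₀
T‡∈𝒯₀ = there (there (here refl))

T♯∈𝒯₀ : T♯ ∈ 𝒯₀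
T♯∈𝒯₀ = there (there (there (here refl)))

proposition12 : (d : ℕ) → 4 ≤ d →
    Σ ℕ (λ k → OneOf k d
      × (∀ k′ → OneOf k′ d → k′ ≡ k)
      × (CaseA k d → DecompIn k d ((ρ′ k ∸ d) · [ T♭ ] ++ (d ∸ ρ k) · [ T† ]))
      × (CaseA′ k d → DecompIn k d ((ρ″ k ∸ d) · [ T† ] ++ (d ∸ ρ′ k) · [ T‡ ]))
      × (CaseA″ k d → DecompIn k d ((ρ‴ k ∸ d) · [ T‡ ] ++ (d ∸ ρ″ k) · [ T♯ ])))
proposition12 d 4≤d with segment-exists ρ-increasing 4≤d
... | k , segment =
  k , segment⇒oneOf segment ,
  (λ k′ oneOf → segment-unique ρ-increasing (oneOf⇒segment oneOf) segment) ,
  (λ (ρ≤d , d<ρ′) → decompIn-mix T♭∈𝒯₀ T†∈𝒯₀ refl refl (ρ≡1+k+3*2^k k) ρ≤d (<⇒≤ d<ρ′)) ,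
  (λ (ρ′≤d , d<ρ″) → decompIn-mix T†∈𝒯₀ T‡∈𝒯₀ refl refl (ρ′≡1+k+4*2^k k) ρ′≤d (<⇒≤ d<ρ″)) ,
  (λ (ρ″≤d , d≤ρ‴) → decompIn-mix T‡∈𝒯₀ T♯∈𝒯₀ refl refl (ρ″≡1+k+5*2^k k) ρ″≤d d≤ρ‴)
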